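{- Every module-composed graph is weakly chordal, i.e. contains no induced cycle of length at least five and no complement of such a cycle as an induced subgraph.
   Context: All graphs are finite, simple and undirected. For a graph $G=(V_G,E_G)$ and $v\in V_G$, $N(v)=\{w\in V_G : \{v,w\}\in E_G\}$. A set $M\subseteq V_G$ is a module of $G$ if for all $v_1,v_2\in M$ we have $N(v_1)\setminus M=N(v_2)\setminus M$ (in particular the empty set, singletons and $V_G$ are modules). For $U\subseteq V_G$, $G[U]$ is the induced subgraph on $U$. A graph $G$ is module-composed if there is a bijection $\varphi:V_G\to\{1,\ldots,|V_G|\}$ such that for every $2\le i\le |V_G|$ the neighbourhood of $\varphi^{ -1}(i)$ in the graph $G[\{\varphi^{ -1}(1),\ldots,\varphi^{ -1}(i-1)\}]$ is a module of that graph. -}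

module Defs where

open import Data.Nat using (ℕ; suc; _+_; _<_)
open import Data.Nat.DivMod using (_%_)
open import Data.Fin using (Fin; toℕ)
open import Data.Bool using (Bool; true; false)
open import Data.Product using (Σ; _×_; ∃)
open import Data.Sum using (_⊎_)
open import Relation.Nullary using (¬_)
open import Relation.Binary.PropositionalEquality using (_≡_; _≢_)
open import Function.Bundles using (_⤖_; _⇔_; Bijection)
open import Function.Definitions using (Injective)

record Graph (n : ℕ) : Set where
  field
    adj    : Fin n → Fin n → Bool
    sym    : ∀ u v → adj u v ≡ adj v u
    irrefl : ∀ v → adj v v ≡ false

open Graph public

Edge : ∀ {n} → Graph n → Fin n → Fin n → Set
Edge G u v = adj G u v ≡ true

-- M is a module of the induced subgraph G[U] (M is assumed to be a subset of U):
-- any two vertices of M have the same neighbours in U \ M.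
IsModuleIn : ∀ {n} → Graph n → (U M : Fin n → Set) → Set
IsModuleIn G U M =
  ∀ v₁ v₂ w → M v₁ → M v₂ → U w → ¬ M w → (Edge G v₁ w ⇔ Edge G v₂ w)

-- G is module-composed: there is a bijection φ : V → {0,…,n-1} (0-based ordering)
-- such that for every vertex x, the neighbourhood of x in the graph induced by
-- the vertices preceding x is a module of that induced graph.
-- (For the first vertex this is vacuous: the empty set is a module.)
ModuleComposed : ∀ {n} → Graph n → Set
ModuleComposed {n} G =
  Σ (Fin n ⤖ Fin n) λ φ →
    let f = Bijection.to φ in
    ∀ x → IsModuleIn G (λ v → toℕ (f v) < toℕ (f x))
                       (λ v → toℕ (f v) < toℕ (f x) × Edge G x v)

CycleAdj : ∀ k → Fin (suc k) → Fin (suc k) → Set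
CycleAdj k i j = (suc (toℕ i) % suc k ≡ toℕ j) ⊎ (suc (toℕ j) % suc k ≡ toℕ i)

CoCycleAdj : ∀ k → Fin (suc k) → Fin (suc k) → Set
CoCycleAdj k i j = i ≢ j × ¬ CycleAdj k i j

HasInduced : ∀ {n} → Graph n → (k : ℕ) → (Fin k → Fin k → Set) → Set
HasInduced G k R =
  Σ (Fin k → Fin _) λ f → Injective _≡_ _≡_ f × (∀ i j → Edge G (f i) (f j) ⇔ R i j)

WeaklyChordal : ∀ {n} → Graph n → Set
WeaklyChordal G =
  ∀ m → ¬ HasInduced G (5 + m) (CycleAdj (4 + m))
      × ¬ HasInduced G (5 + m) (CoCycleAdj (4 + m))

-- Let G be module-composed with respect to an ordering φ, and let H be any
-- induced subgraph of G.  The vertex x of H that comes last in φ sees all other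
-- vertices of H among its predecessors, so its neighbourhood is a module of
-- H - x: whenever a, b are neighbours of x in H and w is a non-neighbour,
-- a ~ w implies b ~ w.  We call such an x a module vertex of H
-- ('induced-module-vertex').
--
-- It therefore suffices to show that neither C_k nor its complement has a
-- module vertex when k ≥ 5.  As the cycle is vertex-transitive, we relabel it
-- so that the candidate vertex sits at position 1 ('Rotation'), and then
--   * in C_k, x = 1 has neighbours 0, 2 and non-neighbour 3 with 2 ~ 3 but 0 ≁ 3;
--   * in the complement, x = 1 has neighbours 3, 4 and non-neighbour 2 with
--     4 ~ 2 but 3 ≁ 2.
-- All needed (non-)adjacencies reduce to distinctness of positions whose
-- offsets differ by 1, 2, 3 or 4, which holds because k ≥ 5.
module Submission where

open import Defs hiding (sym)
open import Data.Nat using (ℕ; suc; _+_; _*_; _<_; _≤?_; s≤s; z≤n; NonZero)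
open import Data.Nat.Properties using (+-assoc; +-comm; +-suc; +-cancelˡ-≡; ≤-trans; m≤m+n; ≤∧≢⇒<; <⇒≱)
open import Data.Nat.DivMod
open import Data.Nat.Divisibility using (_∣_; divides; ∣⇒≤)
open import Data.Fin using (Fin; toℕ; fromℕ<) renaming (zero to fzero)
open import Data.Fin.Properties using (toℕ-fromℕ<; toℕ-injective; toℕ<n)
open import Data.List using (allFin)
open import Data.List.Extrema.Nat using (argmax; f[xs]≤f[argmax])
open import Data.List.Membership.Propositional.Properties using (∈-allFin)
import Data.List.Relation.Unary.All as All
open import Data.Product using (Σ; _,_; proj₂)
open import Data.Sum using (inj₁; inj₂)
open import Relation.Nullary using (¬_)
open import Relation.Nullary.Decidable using (True; toWitness)
open import Relation.Binary.PropositionalEquality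
open import Function.Bundles using (Bijection; Equivalence)

[m%o+n]%o≡[m+n]%o : ∀ m n o .{{_ : NonZero o}} → (m % o + n) % o ≡ (m + n) % o
[m%o+n]%o≡[m+n]%o m n o = begin
  (m % o + n) % o            ≡⟨ %-distribˡ-+ (m % o) n o ⟩
  (m % o % o + n % o) % o    ≡⟨ cong (λ r → (r + n % o) % o) (m%n%n≡m%n m o) ⟩
  (m % o + n % o) % o        ≡⟨ %-distribˡ-+ m n o ⟨
  (m + n) % o                ∎
  where open ≡-Reasoning

[m+n]%o≡m⇒o∣n : ∀ m n o .{{_ : NonZero o}} → (m + n) % o ≡ m → o ∣ n
[m+n]%o≡m⇒o∣n m n o eq = divides ((m + n) / o) (+-cancelˡ-≡ m n _ (begin
  m + n                                ≡⟨ m≡m%n+[m/n]*n (m + n) o ⟩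
  (m + n) % o + (m + n) / o * o        ≡⟨ cong (_+ (m + n) / o * o) eq ⟩
  m + (m + n) / o * o                  ∎))
  where open ≡-Reasoning

cycleAdj-sym : ∀ {K} {i j : Fin (suc K)} → CycleAdj K i j → CycleAdj K j i
cycleAdj-sym (inj₁ e) = inj₂ e
cycleAdj-sym (inj₂ e) = inj₁ e

-- The cycle C_(K+1) relabelled so that a chosen vertex i sits at position 1:
-- position d is the vertex (d - 1) steps after i.
module Rotation (K : ℕ) (i : Fin (suc K)) where

  P : ℕ → ℕ
  P d = (d + (toℕ i + K)) % suc K

  pos : ℕ → Fin (suc K)
  pos d = fromℕ< (m%n<n (d + (toℕ i + K)) (suc K))

  toℕ-pos : ∀ d → toℕ (pos d) ≡ P d
  toℕ-pos d = toℕ-fromℕ< _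

  pos-one : pos 1 ≡ i
  pos-one = toℕ-injective (begin
    toℕ (pos 1)                    ≡⟨ toℕ-pos 1 ⟩
    suc (toℕ i + K) % suc K        ≡⟨ cong (_% suc K) (+-suc (toℕ i) K) ⟨
    (toℕ i + suc K) % suc K        ≡⟨ [m+n]%n≡m%n (toℕ i) (suc K) ⟩
    toℕ i % suc K                  ≡⟨ m<n⇒m%n≡m (toℕ<n i) ⟩
    toℕ i                          ∎)
    where open ≡-Reasoning

  P-shift : ∀ d a → P (d + a) ≡ (P a + d) % suc K
  P-shift d a = begin
    (d + a + t) % suc K              ≡⟨ cong (_% suc K) (+-assoc d a t) ⟩
    (d + (a + t)) % suc K            ≡⟨ cong (_% suc K) (+-comm d (a + t)) ⟩
    (a + t + d) % suc K              ≡⟨ [m%o+n]%o≡[m+n]%o (a + t) d (suc K) ⟨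
    ((a + t) % suc K + d) % suc K    ∎
    where
    t = toℕ i + K
    open ≡-Reasoning

  P-distinct : ∀ a d → 0 < d → d < suc K → P a ≢ P (d + a)
  P-distinct a d@(suc _) _ d<k eq = <⇒≱ d<k (∣⇒≤ k∣d)
    where
    k∣d : suc K ∣ d
    k∣d = [m+n]%o≡m⇒o∣n (P a) d (suc K) (sym (trans eq (P-shift d a)))

  successor : ∀ a → suc (toℕ (pos a)) % suc K ≡ P (suc a)
  successor a = begin
    suc (toℕ (pos a)) % suc K     ≡⟨ cong (λ r → suc r % suc K) (toℕ-pos a) ⟩
    (1 + P a) % suc K             ≡⟨ cong (_% suc K) (+-comm 1 (P a)) ⟩
    (P a + 1) % suc K             ≡⟨ P-shift 1 a ⟨
    P (suc a)                     ∎
    where open ≡-Reasoning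

  pos-adjacent : ∀ a → CycleAdj K (pos a) (pos (suc a))
  pos-adjacent a = inj₁ (trans (successor a) (sym (toℕ-pos (suc a))))

  pos-nonadjacent : ∀ a b → P (suc a) ≢ P b → P (suc b) ≢ P a → ¬ CycleAdj K (pos a) (pos b)
  pos-nonadjacent a b a+1≢b b+1≢a (inj₁ e) = a+1≢b (trans (sym (successor a)) (trans e (toℕ-pos b)))
  pos-nonadjacent a b a+1≢b b+1≢a (inj₂ e) = b+1≢a (trans (sym (successor b)) (trans e (toℕ-pos a)))

module LongCycle (m : ℕ) (i : Fin (5 + m)) where
  open Rotation (4 + m) i public

  apart : ∀ a c {c≤3 : True (c ≤? 3)} → P a ≢ P (suc c + a)
  apart a c {c≤3} = P-distinct a (suc c) (s≤s z≤n) (s≤s (s≤s (≤-trans (toWitness c≤3) (m≤m+n 3 m))))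

  pos-apart : ∀ a c {c≤3 : True (c ≤? 3)} → pos a ≢ pos (suc c + a)
  pos-apart a c {c≤3} eq = apart a c {c≤3} (trans (sym (toℕ-pos a)) (trans (cong toℕ eq) (toℕ-pos (suc c + a))))

ModuleVertex : ∀ {k} → (Fin k → Fin k → Set) → Fin k → Set
ModuleVertex R x =
  ∀ a b w → a ≢ x → b ≢ x → w ≢ x → R x a → R x b → ¬ R x w → R a w → R b w

-- Every induced subgraph of a module-composed graph has a module vertex,
-- namely its vertex that comes last in the module-composing ordering.
induced-module-vertex : ∀ {n K} (G : Graph n) {R : Fin (suc K) → Fin (suc K) → Set} →
  ModuleComposed G → HasInduced G (suc K) R → Σ (Fin (suc K)) (ModuleVertex R)
induced-module-vertex {K = K} G (φ , isModule) (f , f-inj , f-iso) = last , last-is-module-vertex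
  where
  rank : Fin (suc K) → ℕ
  rank j = toℕ (Bijection.to φ (f j))

  last : Fin (suc K)
  last = argmax rank fzero (allFin (suc K))

  before-last : ∀ j → j ≢ last → rank j < rank last
  before-last j j≢last = ≤∧≢⇒<
    (All.lookup (f[xs]≤f[argmax] {f = rank} fzero (allFin (suc K))) (∈-allFin j))
    (λ eq → j≢last (f-inj (Bijection.injective φ (toℕ-injective eq))))

  last-is-module-vertex : ModuleVertex _ last
  last-is-module-vertex a b w a≢ b≢ w≢ Rxa Rxb ¬Rxw Raw =
    Equivalence.to (f-iso b w)
      (Equivalence.to
        (isModule (f last) (f a) (f b) (f w)
          (before-last a a≢ , Equivalence.from (f-iso last a) Rxa)
          (before-last b b≢ , Equivalence.from (f-iso last b) Rxb)
          (before-last w w≢)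
          (λ (_ , Exw) → ¬Rxw (Equivalence.to (f-iso last w) Exw)))
        (Equivalence.from (f-iso a w) Raw))

-- C_k has no module vertex for k ≥ 5: with x at position 1, its neighbours
-- 0 and 2 disagree on the non-neighbour 3.
cycle-has-no-module-vertex : ∀ m x → ¬ ModuleVertex (CycleAdj (4 + m)) x
cycle-has-no-module-vertex m x isModuleVertex =
  pos-nonadjacent 0 3 (apart 1 1) (≢-sym (apart 0 3))
    (isModuleVertex′ (pos 2) (pos 0) (pos 3)
      (≢-sym (pos-apart 1 0)) (pos-apart 0 0) (≢-sym (pos-apart 1 1))
      (pos-adjacent 1) (cycleAdj-sym (pos-adjacent 0))
      (pos-nonadjacent 1 3 (apart 2 0) (≢-sym (apart 1 2)))
      (pos-adjacent 2))
  where
  open LongCycle m x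
  isModuleVertex′ : ModuleVertex (CycleAdj (4 + m)) (pos 1)
  isModuleVertex′ = subst (ModuleVertex _) (sym pos-one) isModuleVertex

-- The complement of C_k has no module vertex for k ≥ 5: with x at position 1,
-- its neighbours 4 and 3 disagree on the non-neighbour 2.
coCycle-has-no-module-vertex : ∀ m x → ¬ ModuleVertex (CoCycleAdj (4 + m)) x
coCycle-has-no-module-vertex m x isModuleVertex =
  proj₂ (isModuleVertex′ (pos 4) (pos 3) (pos 2)
           (≢-sym (pos-apart 1 2)) (≢-sym (pos-apart 1 1)) (≢-sym (pos-apart 1 0))
           (pos-apart 1 2 , pos-nonadjacent 1 4 (apart 2 1) (≢-sym (apart 1 3)))
           (pos-apart 1 1 , pos-nonadjacent 1 3 (apart 2 0) (≢-sym (apart 1 2)))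
           (λ (_ , ¬adj) → ¬adj (pos-adjacent 1))
           (≢-sym (pos-apart 2 1) , pos-nonadjacent 4 2 (≢-sym (apart 2 2)) (apart 3 0)))
        (cycleAdj-sym (pos-adjacent 2))
  where
  open LongCycle m x
  isModuleVertex′ : ModuleVertex (CoCycleAdj (4 + m)) (pos 1)
  isModuleVertex′ = subst (ModuleVertex _) (sym pos-one) isModuleVertex

corollary5 : ∀ {n : ℕ} (G : Graph n) → ModuleComposed G → WeaklyChordal G
corollary5 G composed m = no-induced-cycle , no-induced-coCycle
  where
  no-induced-cycle : ¬ HasInduced G (5 + m) (CycleAdj (4 + m))
  no-induced-cycle copy =
    let (x , isModuleVertex) = induced-module-vertex G composed copy
    in cycle-has-no-module-vertex m x isModuleVertex

  no-induced-coCycle : ¬ HasInduced G (5 + m) (CoCycleAdj (4 + m))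
  no-induced-coCycle copy =
    let (x , isModuleVertex) = induced-module-vertex G composed copy
    in coCycle-has-no-module-vertex m x isModuleVertex
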